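{- Let $m,n\in\mathbb{N}$ and $\zeta>0$ with $\zeta n\in\mathbb{N}$. Let $H$ be a forest in which every component has at most $m$ vertices and in each component a root vertex has been specified. Then there is a set $D\subseteq V(H)$ with $|D|\le m^{m+1}\zeta n$ such that $H\setminus D$ is isomorphic (as a rooted forest) to $F\times\zeta n$ for some forest $F$ whose components are rooted trees, and every root of a component of $F\times\zeta n$ (as it sits in $H\setminus D$) was a root of $H$.
   Context: For a graph $G$ and $U\subseteq V(G)$, $G\setminus U$ is the subgraph induced on $V(G)\setminus U$. For a graph $F$ and $d\in\mathbb{N}$, $F\times d$ denotes the disjoint union of $d$ copies of $F$; if the components of $F$ are rooted trees, each component of $F\times d$ is rooted at the copy of the corresponding root. -}

module Defs where

open import Data.Nat using (ℕ; _≤_)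
open import Data.Fin using (Fin)
open import Data.Fin.Subset using (Subset; _∉_)
open import Data.List using (List; _∷_; length; _∷ʳ_)
open import Data.List.Relation.Unary.All using (All)
open import Data.List.Relation.Unary.Linked using (Linked)
open import Data.List.Relation.Unary.Unique.Propositional using (Unique)
open import Data.Product using (∃-syntax; _×_; _,_)
open import Function.Definitions using (Injective)
open import Relation.Nullary using (¬_)
open import Relation.Binary.PropositionalEquality using (_≡_) renaming (sym to ≡-sym)

record Graph (V : Set) : Set₁ where
  field
    Adj    : V → V → Set
    sym    : ∀ {u v} → Adj u v → Adj v u
    irrefl : ∀ {u} → ¬ Adj u u
open Graph public

module _ {V : Set} (G : Graph V) where

  data Walk : V → V → Set where
    here : ∀ {u} → Walk u u
    step : ∀ {u v w} → Adj G u v → Walk v w → Walk u w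

  Connected : V → V → Set
  Connected = Walk

  Forest : Set
  Forest = ∀ (x : V) (ys : List V) → 2 ≤ length ys → Unique (x ∷ ys)
           → ¬ Linked (Adj G) ((x ∷ ys) ∷ʳ x)

  ComponentsAtMost : ℕ → Set
  ComponentsAtMost m = ∀ (v : V) (us : List V) → Unique us → All (Connected v) us → length us ≤ m

  IsRootedForest : (V → Set) → Set
  IsRootedForest R =
    Forest
    × (∀ v → ∃[ r ] (R r × Connected v r))
    × (∀ r r' → R r → R r' → Connected r r' → r ≡ r')

-- F × d : disjoint union of d copies of F (vertex (i , a) = copy i of a)
_×ᵍ_ : {V : Set} → Graph V → (d : ℕ) → Graph (Fin d × V)
Adj (F ×ᵍ d) (i , a) (j , b) = (i ≡ j) × Adj F a b
sym (F ×ᵍ d) (i≡j , e) = ≡-sym i≡j , sym F e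
irrefl (F ×ᵍ d) (_ , e) = irrefl F e

_×ʳ_ : {V : Set} → (V → Set) → (d : ℕ) → (Fin d × V → Set)
(R ×ʳ d) (i , a) = R a

-- φ : K → H is an isomorphism of K onto the induced subgraph H ∖ D (bijection onto
-- V(H) ∖ D preserving and reflecting adjacency) which maps every root of K to a root of H.
record RootedIsoOntoMinus {N : ℕ} {W : Set} (H : Graph (Fin N)) (RH : Fin N → Set)
       (D : Subset N) (K : Graph W) (RK : W → Set) : Set where
  field
    φ         : W → Fin N
    injective : Injective _≡_ _≡_ φ
    avoids    : ∀ w → φ w ∉ D
    onto      : ∀ v → v ∉ D → ∃[ w ] (φ w ≡ v)
    adj⇒      : ∀ w w' → Adj K w w' → Adj H (φ w) (φ w')
    adj⇐      : ∀ w w' → Adj H (φ w) (φ w') → Adj K w w'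
    roots     : ∀ w → RK w → RH (φ w)

module Submission where

-- In a rooted forest every edge joins a vertex to its parent, the next vertex on its path to the
-- root. List each component from its root and record, for every later vertex, the position of its
-- parent: this key (at most m ^ m of them) determines the component up to rooted isomorphism, and
-- matching positions is the isomorphism. Sort the components of each key into blocks of k; the
-- first component of every complete block becomes a component of F, and its i-th copy is sent to
-- the i-th component of the block. What is deleted is the incomplete last block of every key: fewer
-- than k components of at most m vertices for each of at most m ^ m keys.

-- A separate module, so that its ℕ operators _<_ and _/_ stay apart from the ℚ ones of the statement.
module RootedForestDecomposition where

  open import Defs
  open import Data.Bool using (true; false)
  open import Data.Empty using (⊥-elim)
  open import Function using (_∘_; flip)
  open import Data.Fin as Fin using (Fin; toℕ; fromℕ<; combine; funToFin; finToFun)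
  open import Data.Fin.Properties as Finₚ
    using (toℕ-fromℕ<; fromℕ<-injective; toℕ<n; combine-injective; finToFun-funToFin)
  open import Data.Fin.Subset using (Subset; ∣_∣; _∈_; _∉_)
  open import Data.List using (List; []; _∷_; length; map; filter; allFin; lookup; _++_; _∷ʳ_)
  open import Data.List.Membership.Propositional using () renaming (_∈_ to _∈ₗ_; _∉_ to _∉ₗ_)
  open import Data.List.Membership.Propositional.Properties
    using (∈-map⁻; ∈-lookup; ∈-++⁺ʳ; ∈-++⁻; ∈-filter⁺; ∈-filter⁻; ∈-allFin)
  open import Data.List.Properties using (length-map; map-++)
  open import Data.List.Relation.Unary.All as All using (All; []; _∷_)
  open import Data.List.Relation.Unary.All.Properties using (¬Any⇒All¬)
  open import Data.List.Relation.Unary.AllPairs using ([]; _∷_)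
  open import Data.List.Relation.Unary.Linked using (Linked; []; [-]; _∷_)
  import Data.List.Relation.Unary.Linked.Properties as Linkedₚ
  open import Data.List.Relation.Binary.Subset.Propositional using (_⊆_)
  open import Data.List.Relation.Unary.Any as Any using (here; there)
  open import Data.List.Relation.Unary.Any.Properties using (lookup-index)
  open import Data.List.Relation.Unary.Unique.Propositional using (Unique)
  import Data.List.Relation.Unary.Unique.Propositional.Properties as Uniqueₚ
  open import Data.Nat using (ℕ; zero; suc; _+_; _*_; _∸_; _^_; _≤_; _<_; z≤n; s≤s; z<s; _<?_; NonZero)
  open import Data.Nat.Properties
  open import Data.Nat.DivMod using (_/_; _%_; m<n⇒m%n≡m; %-remove-+ˡ; m%n≡m∸m/n*n; m%n<n; m/n*n≤m; m≡m%n+[m/n]*n)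
  open import Data.Nat.Divisibility using (_∣_; divides; _∣?_; n∣m*n)
  open import Data.Product using (∃-syntax; _×_; _,_; proj₁; proj₂)
  open import Data.Sum using (_⊎_; inj₁; inj₂)
  open import Data.Vec as Vec using ([]; _∷_)
  open import Data.Vec.Properties using (lookup∘tabulate; []=⇒lookup; lookup⇒[]=)
  open import Function.Definitions using (Injective)
  open import Relation.Binary.Definitions using (DecidableEquality)
  open import Relation.Binary.PropositionalEquality as ≡
    using (_≡_; _≢_; refl; cong; cong₂; subst; subst₂; trans; module ≡-Reasoning)
  open import Relation.Nullary using (¬_; Dec; yes; no; does)
  open import Relation.Nullary.Decidable using (dec-true; _×-dec_; ¬?; decidable-stable)
  open import Relation.Unary using (Decidable)

  module ListPosition {A : Set} (_≟_ : DecidableEquality A) where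

    indexOf : A → List A → ℕ
    indexOf x []       = 0
    indexOf x (y ∷ ys) with x ≟ y
    ... | yes _ = 0
    ... | no  _ = suc (indexOf x ys)

    nth : A → List A → ℕ → A
    nth d []       _       = d
    nth d (y ∷ ys) zero    = y
    nth d (y ∷ ys) (suc i) = nth d ys i

    indexOf-head : ∀ x xs → indexOf x (x ∷ xs) ≡ 0
    indexOf-head x xs with x ≟ x
    ... | yes _  = refl
    ... | no x≢x = ⊥-elim (x≢x refl)

    indexOf-< : ∀ {x xs} → x ∈ₗ xs → indexOf x xs < length xs
    indexOf-< {x} {y ∷ ys} x∈ with x ≟ y | x∈
    ... | yes _   | _          = s≤s z≤n
    ... | no  x≢y | here x≡y   = ⊥-elim (x≢y x≡y)
    ... | no  _   | there x∈ys = s≤s (indexOf-< x∈ys)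

    nth-indexOf : ∀ d {x xs} → x ∈ₗ xs → nth d xs (indexOf x xs) ≡ x
    nth-indexOf d {x} {y ∷ ys} x∈ with x ≟ y | x∈
    ... | yes x≡y | _          = ≡.sym x≡y
    ... | no  x≢y | here x≡y   = ⊥-elim (x≢y x≡y)
    ... | no  _   | there x∈ys = nth-indexOf d x∈ys

    nth-∈ : ∀ d xs {i} → i < length xs → nth d xs i ∈ₗ xs
    nth-∈ d (y ∷ ys) {zero}  _         = here refl
    nth-∈ d (y ∷ ys) {suc i} (s≤s i<) = there (nth-∈ d ys i<)

    indexOf-nth : ∀ d {xs i} → Unique xs → i < length xs → indexOf (nth d xs i) xs ≡ i
    indexOf-nth d {y ∷ ys} {zero}  _          _        = indexOf-head y ys
    indexOf-nth d {y ∷ ys} {suc i} (y∉ ∷ uniq) (s≤s i<) with nth d ys i ≟ y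
    ... | yes eq = ⊥-elim (All.lookup y∉ (nth-∈ d ys i<) (≡.sym eq))
    ... | no  _  = cong suc (indexOf-nth d uniq i<)

    indexOf-injective : ∀ {x y xs} → x ∈ₗ xs → y ∈ₗ xs → indexOf x xs ≡ indexOf y xs → x ≡ y
    indexOf-injective {x} {y} {xs} x∈ y∈ eq = begin
      x                       ≡⟨ nth-indexOf x x∈ ⟨
      nth x xs (indexOf x xs) ≡⟨ cong (nth x xs) eq ⟩
      nth x xs (indexOf y xs) ≡⟨ nth-indexOf x y∈ ⟩
      y                       ∎
      where open ≡-Reasoning

  lookup-injective : ∀ {A : Set} {xs : List A} → Unique xs → Injective _≡_ _≡_ (lookup xs)
  lookup-injective {xs = x ∷ xs} (x∉ ∷ uniq) {Fin.zero}  {Fin.zero}  _  = refl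
  lookup-injective {xs = x ∷ xs} (x∉ ∷ uniq) {Fin.zero}  {Fin.suc j} eq = ⊥-elim (All.lookup x∉ (∈-lookup j) eq)
  lookup-injective {xs = x ∷ xs} (x∉ ∷ uniq) {Fin.suc i} {Fin.zero}  eq = ⊥-elim (All.lookup x∉ (∈-lookup i) (≡.sym eq))
  lookup-injective {xs = x ∷ xs} (x∉ ∷ uniq) {Fin.suc i} {Fin.suc j} eq = cong Fin.suc (lookup-injective uniq eq)

  members : ∀ {n} → Subset n → List (Fin n)
  members []          = []
  members (true ∷ p)  = Fin.zero ∷ map Fin.suc (members p)
  members (false ∷ p) = map Fin.suc (members p)

  ∣p∣≡length-members : ∀ {n} (p : Subset n) → ∣ p ∣ ≡ length (members p)
  ∣p∣≡length-members []          = refl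
  ∣p∣≡length-members (true ∷ p)  =
    cong suc (trans (∣p∣≡length-members p) (≡.sym (length-map Fin.suc (members p))))
  ∣p∣≡length-members (false ∷ p) = trans (∣p∣≡length-members p) (≡.sym (length-map Fin.suc (members p)))

  members-unique : ∀ {n} (p : Subset n) → Unique (members p)
  members-unique []          = []
  members-unique (true ∷ p)  = All.tabulate zero∉ ∷ Uniqueₚ.map⁺ Finₚ.suc-injective (members-unique p)
    where
    zero∉ : ∀ {x} → x ∈ₗ map Fin.suc (members p) → Fin.zero ≢ x
    zero∉ x∈ refl with ∈-map⁻ Fin.suc x∈
    ... | _ , _ , ()
  members-unique (false ∷ p) = Uniqueₚ.map⁺ Finₚ.suc-injective (members-unique p)

  ∈-members : ∀ {n} (p : Subset n) {x} → x ∈ₗ members p → x ∈ p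
  ∈-members (true ∷ p) (here refl) = Vec.here
  ∈-members (true ∷ p) (there x∈) with ∈-map⁻ Fin.suc x∈
  ... | y , y∈ , refl = Vec.there (∈-members p y∈)
  ∈-members (false ∷ p) x∈ with ∈-map⁻ Fin.suc x∈
  ... | y , y∈ , refl = Vec.there (∈-members p y∈)

  ∣p∣≤-injection : ∀ {n X} (p : Subset n) (e : ∀ x → x ∈ p → Fin X) →
                   (∀ {x y} x∈ y∈ → e x x∈ ≡ e y y∈ → x ≡ y) → ∣ p ∣ ≤ X
  ∣p∣≤-injection p e e-inj =
    subst (_≤ _) (≡.sym (∣p∣≡length-members p)) (Finₚ.injective⇒≤ {f = eₗ} eₗ-injective)
    where
    member∈ : ∀ i → lookup (members p) i ∈ p
    member∈ i = ∈-members p (∈-lookup i)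
    eₗ : Fin (length (members p)) → Fin _
    eₗ i = e (lookup (members p) i) (member∈ i)
    eₗ-injective : Injective _≡_ _≡_ eₗ
    eₗ-injective eq = lookup-injective (members-unique p) (e-inj (member∈ _) (member∈ _) eq)

  select : ∀ {n} {P : Fin n → Set} → Decidable P → Subset n
  select P? = Vec.tabulate (λ x → does (P? x))

  ∈-select⁻ : ∀ {n} {P : Fin n → Set} (P? : Decidable P) {x} → x ∈ select P? → P x
  ∈-select⁻ P? {x} x∈ with P? x | trans (≡.sym (lookup∘tabulate _ x)) ([]=⇒lookup x∈)
  ... | yes Px | _ = Px

  ∈-select⁺ : ∀ {n} {P : Fin n → Set} (P? : Decidable P) {x} → P x → x ∈ select P?
  ∈-select⁺ P? {x} Px = lookup⇒[]= x (select P?) (trans (lookup∘tabulate _ x) (dec-true (P? x) Px))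

  block-< : ∀ {n q i k} → k ∣ n → n < q * k → i < k → n + i < q * k
  block-< {n} {q} {i} {k} (divides p refl) n<qk i<k = begin-strict
    p * k + i  <⟨ +-monoʳ-< (p * k) i<k ⟩
    p * k + k  ≡⟨ +-comm (p * k) k ⟩
    suc p * k  ≤⟨ *-monoˡ-≤ k (*-cancelʳ-< k p q n<qk) ⟩
    q * k      ∎
    where open ≤-Reasoning

  offset-unique : ∀ {a b i j k} .{{_ : NonZero k}} → k ∣ a → k ∣ b → i < k → j < k → a + i ≡ b + j → i ≡ j
  offset-unique {a} {b} {i} {j} {k} k∣a k∣b i<k j<k eq = begin
    i            ≡⟨ m<n⇒m%n≡m i<k ⟨
    i % k        ≡⟨ %-remove-+ˡ i k∣a ⟨
    (a + i) % k  ≡⟨ cong (_% k) eq ⟩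
    (b + j) % k  ≡⟨ %-remove-+ˡ j k∣b ⟩
    j % k        ≡⟨ m<n⇒m%n≡m j<k ⟩
    j            ∎
    where open ≡-Reasoning

  remainder-offset-< : ∀ {a c k} .{{_ : NonZero k}} → a < c → (c / k) * k ≤ a → a ∸ (c / k) * k < k
  remainder-offset-< {a} {c} {k} a<c full≤a = begin-strict
    a ∸ (c / k) * k  <⟨ ∸-monoˡ-< a<c full≤a ⟩
    c ∸ (c / k) * k  ≡⟨ m%n≡m∸m/n*n c k ⟨
    c % k            <⟨ m%n<n c k ⟩
    k                ∎
    where open ≤-Reasoning

  m*[k*m^m]≡m^[m+1]*k : ∀ m k → m * (k * m ^ m) ≡ m ^ (m + 1) * k
  m*[k*m^m]≡m^[m+1]*k m k = begin
    m * (k * m ^ m)  ≡⟨ cong (m *_) (*-comm k (m ^ m)) ⟩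
    m * (m ^ m * k)  ≡⟨ *-assoc m (m ^ m) k ⟨
    m ^ suc m * k    ≡⟨ cong (λ e → m ^ e * k) (+-comm 1 m) ⟩
    m ^ (m + 1) * k  ∎
    where open ≡-Reasoning

  module Walks {V : Set} (G : Graph V) where

    _◅◅_ : ∀ {u v w} → Walk G u v → Walk G v w → Walk G u w
    here     ◅◅ q = q
    step e p ◅◅ q = step e (p ◅◅ q)

    reverse : ∀ {u v} → Walk G u v → Walk G v u
    reverse here       = here
    reverse (step e p) = reverse p ◅◅ step (sym G e) here

    vertices : ∀ {u v} → Walk G u v → List V
    vertices {u} here       = u ∷ []
    vertices {u} (step _ p) = u ∷ vertices p

    start∈vertices : ∀ {u v} (p : Walk G u v) → u ∈ₗ vertices p
    start∈vertices here       = here refl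
    start∈vertices (step _ _) = here refl

    vertices-◅◅ : ∀ {u v w} (p : Walk G u v) (q : Walk G v w) → vertices (p ◅◅ q) ⊆ vertices p ++ vertices q
    vertices-◅◅ {u} here q z∈        = ∈-++⁺ʳ (u ∷ []) z∈
    vertices-◅◅ (step _ p) q (here z≡)  = here z≡
    vertices-◅◅ (step _ p) q (there z∈) = there (vertices-◅◅ p q z∈)

    vertices-reverse : ∀ {u v} (p : Walk G u v) → vertices (reverse p) ⊆ vertices p
    vertices-reverse here z∈ = z∈
    vertices-reverse (step e p) z∈
      with ∈-++⁻ (vertices (reverse p)) (vertices-◅◅ (reverse p) (step (sym G e) here) z∈)
    ... | inj₁ z∈p                = there (vertices-reverse p z∈p)
    ... | inj₂ (here refl)         = there (start∈vertices p)
    ... | inj₂ (there (here refl)) = here refl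

  module SimplePaths {V : Set} (_≟_ : DecidableEquality V) (G : Graph V) where

    open import Data.List.Membership.DecPropositional _≟_ using (_∈?_)
    module W = Walks G

    mutual
      data Path : V → V → Set where
        trivial : ∀ u → Path u u
        cons    : ∀ {u w v} → Adj G u w → (p : Path w v) → u ∉ₗ vertices p → Path u v

      vertices : ∀ {u v} → Path u v → List V
      vertices (trivial u)       = u ∷ []
      vertices (cons {u} _ p _) = u ∷ vertices p

    end∈vertices : ∀ {u v} (p : Path u v) → v ∈ₗ vertices p
    end∈vertices (trivial _)  = here refl
    end∈vertices (cons _ p _) = there (end∈vertices p)

    vertices-unique : ∀ {u v} (p : Path u v) → Unique (vertices p)
    vertices-unique (trivial _)     = [] ∷ []
    vertices-unique (cons _ p u∉p) = ¬Any⇒All¬ (vertices p) u∉p ∷ vertices-unique p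

    linked-∷ʳ : ∀ {u v z} (p : Path u v) → Adj G v z → Linked (Adj G) (vertices p ∷ʳ z)
    linked-∷ʳ (trivial _)                    e = e ∷ [-]
    linked-∷ʳ (cons e′ (trivial _) _)        e = e′ ∷ linked-∷ʳ (trivial _) e
    linked-∷ʳ (cons e′ p@(cons _ _ _) _)     e = e′ ∷ linked-∷ʳ p e

    suffix : ∀ {u w v} (p : Path w v) → u ∈ₗ vertices p → Path u v
    suffix (trivial _)      (here refl) = trivial _
    suffix p@(cons _ _ _)   (here refl) = p
    suffix (cons _ p _)     (there u∈)  = suffix p u∈

    suffix-⊆ : ∀ {u w v} (p : Path w v) (u∈ : u ∈ₗ vertices p) → vertices (suffix p u∈) ⊆ vertices p
    suffix-⊆ (trivial _)    (here refl) z∈ = z∈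
    suffix-⊆ (cons _ _ _)   (here refl) z∈ = z∈
    suffix-⊆ (cons _ p _)   (there u∈)  z∈ = there (suffix-⊆ p u∈ z∈)

    prepend : ∀ {u w v} → Adj G u w → Path w v → Path u v
    prepend {u} e p with u ∈? vertices p
    ... | yes u∈p = suffix p u∈p
    ... | no  u∉p = cons e p u∉p

    prepend-⊆ : ∀ {u w v} (e : Adj G u w) (p : Path w v) → vertices (prepend e p) ⊆ u ∷ vertices p
    prepend-⊆ {u} e p z∈ with u ∈? vertices p
    ... | yes u∈p = there (suffix-⊆ p u∈p z∈)
    ... | no  _   = z∈

    fromWalk : ∀ {u v} → Walk G u v → Path u v
    fromWalk {u} here = trivial u
    fromWalk (step e w) = prepend e (fromWalk w)

    fromWalk-⊆ : ∀ {u v} (w : Walk G u v) → vertices (fromWalk w) ⊆ W.vertices w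
    fromWalk-⊆ here z∈ = z∈
    fromWalk-⊆ (step e w) z∈ with prepend-⊆ e (fromWalk w) z∈
    ... | here z≡   = here z≡
    ... | there z∈′ = there (fromWalk-⊆ w z∈′)

    toWalk : ∀ {u v} → Path u v → Walk G u v
    toWalk (trivial _)  = here
    toWalk (cons e p _) = step e (toWalk p)

    toWalk-⊆ : ∀ {u v} (p : Path u v) → W.vertices (toWalk p) ⊆ vertices p
    toWalk-⊆ (trivial _)  z∈         = z∈
    toWalk-⊆ (cons _ _ _) (here z≡)  = here z≡
    toWalk-⊆ (cons _ p _) (there z∈) = there (toWalk-⊆ p z∈)

    vertices-nonempty : ∀ {u v} (p : Path u v) → 1 ≤ length (vertices p)
    vertices-nonempty (trivial _)  = s≤s z≤n
    vertices-nonempty (cons _ _ _) = s≤s z≤n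

    next : ∀ {u v} → Path u v → V
    next (trivial u)          = u
    next (cons {w = w} _ _ _) = w

    walk-to-next : ∀ {u v} (p : Path u v) → Walk G u (next p)
    walk-to-next (trivial _)  = here
    walk-to-next (cons e _ _) = step e here

    next-adj : ∀ {u v} (p : Path u v) → u ≢ v → Adj G u (next p)
    next-adj (trivial _)  u≢u = ⊥-elim (u≢u refl)
    next-adj (cons e _ _) _   = e

    module _ (forest : Forest G) where

      common-neighbour⇒trivial : ∀ {u a b} → Adj G u a → Adj G b u → (r : Path a b) → u ∉ₗ vertices r → a ≡ b
      common-neighbour⇒trivial _  _  (trivial _)      _   = refl
      common-neighbour⇒trivial {u} ua bu r@(cons _ p _) u∉r =
        ⊥-elim (forest u (vertices r) (s≤s (vertices-nonempty p))
                       (¬Any⇒All¬ (vertices r) u∉r ∷ vertices-unique r)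
                       (ua ∷ linked-∷ʳ r bu))

      next-unique : ∀ {u v} (p q : Path u v) → u ≢ v → next p ≡ next q
      next-unique (trivial _)     _               u≢u = ⊥-elim (u≢u refl)
      next-unique (cons _ _ _)    (trivial _)     u≢u = ⊥-elim (u≢u refl)
      -- Distinct second vertices would be joined, through v, by a path avoiding u: a cycle at u.
      next-unique {u} (cons ua p u∉p) (cons ub q u∉q) _ =
        common-neighbour⇒trivial ua (sym G ub) (fromWalk p⇝q) u∉
        where
        p⇝q = toWalk p W.◅◅ W.reverse (toWalk q)
        u∉ : u ∉ₗ vertices (fromWalk p⇝q)
        u∉ u∈ with ∈-++⁻ _ (W.vertices-◅◅ (toWalk p) _ (fromWalk-⊆ p⇝q u∈))
        ... | inj₁ u∈p = u∉p (toWalk-⊆ p u∈p)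
        ... | inj₂ u∈q = u∉q (toWalk-⊆ q (W.vertices-reverse (toWalk q) u∈q))

  module RootedForest {V : Set} (_≟_ : DecidableEquality V) (G : Graph V) (R : V → Set)
                      (rooted : IsRootedForest G R) where

    open import Data.List.Membership.DecPropositional _≟_ using (_∈?_)
    open Walks G using (_◅◅_; reverse)
    open SimplePaths _≟_ G

    root : V → V
    root v = proj₁ (proj₁ (proj₂ rooted) v)

    root-isRoot : ∀ v → R (root v)
    root-isRoot v = proj₁ (proj₂ (proj₁ (proj₂ rooted) v))

    walk-to-root : ∀ v → Walk G v (root v)
    walk-to-root v = proj₂ (proj₂ (proj₁ (proj₂ rooted) v))

    roots-unique : ∀ {r s} → R r → R s → Walk G r s → r ≡ s
    roots-unique = proj₂ (proj₂ rooted) _ _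

    walk⇒root≡ : ∀ {u v} → Walk G u v → root u ≡ root v
    walk⇒root≡ {u} {v} w =
      roots-unique (root-isRoot u) (root-isRoot v) (reverse (walk-to-root u) ◅◅ (w ◅◅ walk-to-root v))

    adj⇒root≡ : ∀ {u v} → Adj G u v → root u ≡ root v
    adj⇒root≡ e = walk⇒root≡ (step e here)

    root-idem : ∀ v → root (root v) ≡ root v
    root-idem v = ≡.sym (walk⇒root≡ (walk-to-root v))

    isRoot⇒root≡ : ∀ {v} → R v → root v ≡ v
    isRoot⇒root≡ {v} Rv = roots-unique (root-isRoot v) Rv (reverse (walk-to-root v))

    root-root : ∀ {x r} → root x ≡ r → root r ≡ r
    root-root {x} refl = root-idem x

    walk-from-root : ∀ {r v} → root v ≡ r → Walk G r v
    walk-from-root refl = reverse (walk-to-root _)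

    parent : V → V
    parent v = next (fromWalk (walk-to-root v))

    parent-adj : ∀ {v} → v ≢ root v → Adj G v (parent v)
    parent-adj {v} = next-adj (fromWalk (walk-to-root v))

    root-parent : ∀ v → root (parent v) ≡ root v
    root-parent v = ≡.sym (walk⇒root≡ (walk-to-next (fromWalk (walk-to-root v))))

    path-to-root-starts-at-parent : ∀ {v t} (p : Path v t) → root v ≡ t → v ≢ t → parent v ≡ next p
    path-to-root-starts-at-parent {v} p refl = next-unique (proj₁ rooted) (fromWalk (walk-to-root v)) p

    private
      child-of-path-vertex : ∀ {x y t} → Adj G x y → (p : Path y t) → root y ≡ t → x ∈ₗ vertices p →
                             y ≢ t × x ≡ parent y
      child-of-path-vertex e (trivial _)  _ (here refl) = ⊥-elim (irrefl G e)
      child-of-path-vertex e (cons _ _ _) _ (here refl) = ⊥-elim (irrefl G e)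
      child-of-path-vertex {x} {y} e (cons _ q y∉q) rt (there x∈q) =
        y≢t , ≡.sym (path-to-root-starts-at-parent (cons (sym G e) (suffix q x∈q) (y∉q ∘ suffix-⊆ q x∈q)) rt y≢t)
        where
        y≢t : y ≢ _
        y≢t refl = y∉q (end∈vertices q)

    adj⇒parent : ∀ {x y} → Adj G x y → (y ≢ root y × x ≡ parent y) ⊎ (x ≢ root x × y ≡ parent x)
    adj⇒parent {x} {y} e with x ∈? vertices (fromWalk (walk-to-root y))
    ... | yes x∈ = inj₁ (child-of-path-vertex e (fromWalk (walk-to-root y)) refl x∈)
    ... | no  x∉ = inj₂ (x≢ry ∘ (λ x≡rx → trans x≡rx (adj⇒root≡ e)) ,
                        ≡.sym (path-to-root-starts-at-parent (cons e _ x∉) (adj⇒root≡ e) x≢ry))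
      where
      x≢ry : x ≢ root y
      x≢ry refl = x∉ (end∈vertices _)

  module Induced {N : ℕ} (G : Graph (Fin N)) {P : Fin N → Set} (P? : Decidable P) where

    selected : List (Fin N)
    selected = filter P? (allFin N)

    order : ℕ
    order = length selected

    embed : Fin order → Fin N
    embed = lookup selected

    embed-injective : Injective _≡_ _≡_ embed
    embed-injective = lookup-injective (Uniqueₚ.filter⁺ P? (Uniqueₚ.allFin⁺ N))

    embed-P : ∀ a → P (embed a)
    embed-P a = proj₂ (∈-filter⁻ P? {xs = allFin N} (∈-lookup a))

    preimage : ∀ {v} → P v → Fin order
    preimage {v} Pv = Any.index (∈-filter⁺ P? (∈-allFin v) Pv)

    embed-preimage : ∀ {v} (Pv : P v) → embed (preimage Pv) ≡ v
    embed-preimage {v} Pv = ≡.sym (lookup-index (∈-filter⁺ P? (∈-allFin v) Pv))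

    induced : Graph (Fin order)
    Adj    induced a b = Adj G (embed a) (embed b)
    sym    induced     = sym G
    irrefl induced     = irrefl G

    walk-embed : ∀ {a b} → Walk induced a b → Walk G (embed a) (embed b)
    walk-embed here       = here
    walk-embed (step e w) = step e (walk-embed w)

    induced-forest : Forest G → Forest induced
    induced-forest forest x ys 2≤ys unique linked =
      forest (embed x) (map embed ys) (subst (2 ≤_) (≡.sym (length-map embed ys)) 2≤ys)
             (Uniqueₚ.map⁺ embed-injective unique)
             (subst (Linked (Adj G)) (map-++ embed (x ∷ ys) (x ∷ [])) (Linkedₚ.map⁺ linked))

    module _ (P-closed : ∀ {u v} → Adj G u v → P u → P v) where

      walk-P : ∀ {u v} → Walk G u v → P u → P v
      walk-P here       Pu = Pu
      walk-P (step e w) Pu = walk-P w (P-closed e Pu)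

      walk-lift : ∀ {u v} → Walk G u v → P u → ∀ {a b} → embed a ≡ u → embed b ≡ v → Walk induced a b
      walk-lift here       _  a↦u b↦v = subst (Walk induced _) (embed-injective (trans a↦u (≡.sym b↦v))) here
      walk-lift (step e w) Pu a↦u b↦v =
        step (subst₂ (Adj G) (≡.sym a↦u) (≡.sym (embed-preimage Pv)) e) (walk-lift w Pv (embed-preimage Pv) b↦v)
        where Pv = P-closed e Pu

      induced-rooted : ∀ {R} → IsRootedForest G R → IsRootedForest induced (R ∘ embed)
      induced-rooted {R} (forest , has-root , roots-unique) = induced-forest forest , has-rootᵢ , roots-uniqueᵢ
        where
        has-rootᵢ : ∀ a → ∃[ r ] (R (embed r) × Walk induced a r)
        has-rootᵢ a with has-root (embed a)
        ... | r , Rr , w = preimage Pr , subst R (≡.sym (embed-preimage Pr)) Rr ,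
                           walk-lift w (embed-P a) refl (embed-preimage Pr)
          where Pr = walk-P w (embed-P a)
        roots-uniqueᵢ : ∀ a b → R (embed a) → R (embed b) → Walk induced a b → a ≡ b
        roots-uniqueᵢ a b Ra Rb w = embed-injective (roots-unique _ _ Ra Rb (walk-embed w))

  module Components {N : ℕ} (H : Graph (Fin N)) (RH : Fin N → Set) (rooted : IsRootedForest H RH)
                    (m : ℕ) (small : ComponentsAtMost H m) where

    open RootedForest (Finₚ._≟_ {N}) H RH rooted public
    open ListPosition (Finₚ._≟_ {N})

    other? : ∀ r x → Dec (root x ≡ r × x ≢ r)
    other? r x = (root x Finₚ.≟ r) ×-dec ¬? (x Finₚ.≟ r)

    others : Fin N → List (Fin N)
    others r = filter (other? r) (allFin N)

    -- For a non-root r nothing has root r, so component r is then just [ r ].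
    component : Fin N → List (Fin N)
    component r = r ∷ others r

    size : Fin N → ℕ
    size r = length (component r)

    ∈-others⁻ : ∀ {r x} → x ∈ₗ others r → root x ≡ r
    ∈-others⁻ {r} x∈ = proj₁ (proj₂ (∈-filter⁻ (other? r) {xs = allFin N} x∈))

    ∈-component : ∀ {r x} → root x ≡ r → x ∈ₗ component r
    ∈-component {r} {x} rx≡r with x Finₚ.≟ r
    ... | yes x≡r = here x≡r
    ... | no  x≢r = there (∈-filter⁺ (other? r) (∈-allFin x) (rx≡r , x≢r))

    ∈-component⁻ : ∀ {r x} → root r ≡ r → x ∈ₗ component r → root x ≡ r
    ∈-component⁻ rr (here refl) = rr
    ∈-component⁻ rr (there x∈)  = ∈-others⁻ x∈

    component-unique : ∀ r → Unique (component r)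
    component-unique r =
      All.tabulate (λ r∈ r≡ → proj₂ (proj₂ (∈-filter⁻ (other? r) {xs = allFin N} r∈)) (≡.sym r≡))
      ∷ Uniqueₚ.filter⁺ (other? r) (Uniqueₚ.allFin⁺ N)

    size≤m : ∀ r → size r ≤ m
    size≤m r = small r (component r) (component-unique r) (All.tabulate walk-from-r)
      where
      walk-from-r : ∀ {x} → x ∈ₗ component r → Walk H r x
      walk-from-r (here refl) = here
      walk-from-r (there x∈)  = walk-from-root (∈-others⁻ x∈)

    position : Fin N → Fin N → ℕ
    position r x = indexOf x (component r)

    vertexAt : Fin N → ℕ → Fin N
    vertexAt r = nth r (component r)

    position-< : ∀ {r x} → root x ≡ r → position r x < size r
    position-< rx≡r = indexOf-< (∈-component rx≡r)

    position-self : ∀ r → position r r ≡ 0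
    position-self r = indexOf-head r (others r)

    vertexAt-position : ∀ {r x} → root x ≡ r → vertexAt r (position r x) ≡ x
    vertexAt-position rx≡r = nth-indexOf _ (∈-component rx≡r)

    position-vertexAt : ∀ r {i} → i < size r → position r (vertexAt r i) ≡ i
    position-vertexAt r = indexOf-nth r (component-unique r)

    position-injective : ∀ {r x y} → root x ≡ r → root y ≡ r → position r x ≡ position r y → x ≡ y
    position-injective rx≡r ry≡r = indexOf-injective (∈-component rx≡r) (∈-component ry≡r)

    position-nonzero : ∀ {r x} → root x ≡ r → x ≢ r → 0 < position r x
    position-nonzero {r} rx≡r x≢r =
      n≢0⇒n>0 (x≢r ∘ position-injective rx≡r (root-root rx≡r) ∘ flip trans (≡.sym (position-self r)))

    root-vertexAt : ∀ {r j} → 0 < j → j < size r → root (vertexAt r j) ≡ r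
    root-vertexAt {r} {suc j} _ (s≤s j<) = ∈-others⁻ (nth-∈ r (others r) j<)

    shape : Fin N → ℕ → ℕ
    shape r zero    = length (others r)
    shape r (suc j) with suc j <? size r
    ... | yes _ = position r (parent (vertexAt r (suc j)))
    ... | no  _ = 0

    shape-nonzero : ∀ {r j} → 0 < j → j < size r → shape r j ≡ position r (parent (vertexAt r j))
    shape-nonzero {r} {suc j} _ j< with suc j <? size r
    ... | yes _ = refl
    ... | no  ≮ = ⊥-elim (≮ j<)

    shape-< : ∀ r j → shape r j < m
    shape-< r zero    = size≤m r
    shape-< r (suc j) with suc j <? size r
    ... | yes j< = <-≤-trans (position-< (trans (root-parent _) (root-vertexAt z<s j<))) (size≤m r)
    ... | no  _  = <-≤-trans z<s (size≤m r)

    code : Fin N → Fin m → Fin m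
    code r j = fromℕ< (shape-< r (toℕ j))

    key : Fin N → Fin (m ^ m)
    key r = funToFin (code r)

    key≡⇒shape≡ : ∀ {r s} → key r ≡ key s → ∀ {j} → j < m → shape r j ≡ shape s j
    key≡⇒shape≡ {r} {s} same {j} j<m = begin
      shape r j                ≡⟨ cong (shape r) (toℕ-fromℕ< j<m) ⟨
      shape r (toℕ i)          ≡⟨ toℕ-fromℕ< _ ⟨
      toℕ (code r i)           ≡⟨ cong toℕ (finToFun-funToFin (code r) i) ⟨
      toℕ (finToFun (key r) i) ≡⟨ cong (λ c → toℕ (finToFun c i)) same ⟩
      toℕ (finToFun (key s) i) ≡⟨ cong toℕ (finToFun-funToFin (code s) i) ⟩
      toℕ (code s i)           ≡⟨ toℕ-fromℕ< _ ⟩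
      shape s (toℕ i)          ≡⟨ cong (shape s) (toℕ-fromℕ< j<m) ⟩
      shape s j                ∎
      where
      open ≡-Reasoning
      i = fromℕ< j<m

    transport : Fin N → Fin N → Fin N → Fin N
    transport r s x = vertexAt s (position r x)

    transport-self : ∀ r s → transport r s r ≡ s
    transport-self r s = cong (vertexAt s) (position-self r)

    module Transport {r s} (rr : root r ≡ r) (rs : root s ≡ s) (same-key : key r ≡ key s) where

      size≡ : size r ≡ size s
      size≡ = cong suc (key≡⇒shape≡ same-key (<-≤-trans z<s (size≤m r)))

      position-<ˢ : ∀ {x} → root x ≡ r → position r x < size s
      position-<ˢ {x} rx≡r = subst (position r x <_) size≡ (position-< rx≡r)

      transport-root : ∀ {x} → root x ≡ r → root (transport r s x) ≡ s
      transport-root rx≡r = ∈-component⁻ rs (nth-∈ s (component s) (position-<ˢ rx≡r))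

      position-transport : ∀ {x} → root x ≡ r → position s (transport r s x) ≡ position r x
      position-transport rx≡r = position-vertexAt s (position-<ˢ rx≡r)

      transport-inverse : ∀ {x} → root x ≡ r → transport s r (transport r s x) ≡ x
      transport-inverse rx≡r = trans (cong (vertexAt r) (position-transport rx≡r)) (vertexAt-position rx≡r)

      transport-injective : ∀ {x y} → root x ≡ r → root y ≡ r → transport r s x ≡ transport r s y → x ≡ y
      transport-injective {x} {y} rx≡r ry≡r eq = position-injective rx≡r ry≡r (begin
        position r x                 ≡⟨ position-transport rx≡r ⟨
        position s (transport r s x) ≡⟨ cong (position s) eq ⟩
        position s (transport r s y) ≡⟨ position-transport ry≡r ⟩
        position r y                 ∎)
        where open ≡-Reasoning

      transport-nonroot : ∀ {y} → root y ≡ r → y ≢ r → transport r s y ≢ s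
      transport-nonroot ry≡r y≢r ty≡s = <⇒≢ (position-nonzero ry≡r y≢r)
        (≡.sym (trans (≡.sym (position-transport ry≡r)) (trans (cong (position s) ty≡s) (position-self s))))

      transport-parent : ∀ {y} → root y ≡ r → y ≢ r → parent (transport r s y) ≡ transport r s (parent y)
      transport-parent {y} ry≡r y≢r = position-injective
        (trans (root-parent _) (transport-root ry≡r)) (transport-root rpy≡r) (begin
          position s (parent (vertexAt s j)) ≡⟨ shape-nonzero 0<j (position-<ˢ ry≡r) ⟨
          shape s j                          ≡⟨ key≡⇒shape≡ same-key (<-≤-trans j<size (size≤m r)) ⟨
          shape r j                          ≡⟨ shape-nonzero 0<j j<size ⟩
          position r (parent (vertexAt r j)) ≡⟨ cong (position r ∘ parent) (vertexAt-position ry≡r) ⟩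
          position r (parent y)              ≡⟨ position-transport rpy≡r ⟨
          position s (transport r s (parent y)) ∎)
        where
        open ≡-Reasoning
        j = position r y
        0<j = position-nonzero ry≡r y≢r
        j<size = position-< ry≡r
        rpy≡r = trans (root-parent y) ry≡r

      child-adj : ∀ {z} → root z ≡ r → z ≢ root z → Adj H (transport r s z) (transport r s (parent z))
      child-adj rz≡r z≢rz = subst (Adj H _) (transport-parent rz≡r z≢r)
        (parent-adj (transport-nonroot rz≡r z≢r ∘ flip trans (transport-root rz≡r)))
        where z≢r = z≢rz ∘ flip trans (≡.sym rz≡r)

      transport-adj : ∀ {x y} → root x ≡ r → root y ≡ r → Adj H x y → Adj H (transport r s x) (transport r s y)
      transport-adj rx≡r ry≡r e with adj⇒parent e
      ... | inj₁ (y≢ry , refl) = sym H (child-adj ry≡r y≢ry)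
      ... | inj₂ (x≢rx , refl) = child-adj rx≡r x≢rx

    transport-reflects-adj : ∀ {r s} → root r ≡ r → root s ≡ s → key r ≡ key s → ∀ {x y} → root x ≡ r → root y ≡ r →
                             Adj H (transport r s x) (transport r s y) → Adj H x y
    transport-reflects-adj rr rs same rx≡r ry≡r e =
      subst₂ (Adj H) (transport-inverse rx≡r) (transport-inverse ry≡r)
        (Back.transport-adj (transport-root rx≡r) (transport-root ry≡r) e)
      where
      open Transport rr rs same
      module Back = Transport rs rr (≡.sym same)

  module Decomposition {N : ℕ} (H : Graph (Fin N)) (RH : Fin N → Set) (rooted : IsRootedForest H RH)
                       (m : ℕ) (small : ComponentsAtMost H m) (k : ℕ) .{{_ : NonZero k}} where

    open Components H RH rooted m small public
    open ListPosition (Finₚ._≟_ {N})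

    rootWithKey? : ∀ κ r → Dec (root r ≡ r × key r ≡ κ)
    rootWithKey? κ r = (root r Finₚ.≟ r) ×-dec (key r Finₚ.≟ κ)

    rootsWithKey : Fin (m ^ m) → List (Fin N)
    rootsWithKey κ = filter (rootWithKey? κ) (allFin N)

    classSize : Fin N → ℕ
    classSize r = length (rootsWithKey (key r))

    rank : Fin N → ℕ
    rank r = indexOf r (rootsWithKey (key r))

    rankedRoot : Fin N → ℕ → Fin N
    rankedRoot r = nth r (rootsWithKey (key r))

    ∈-rootsWithKey : ∀ {r} → root r ≡ r → r ∈ₗ rootsWithKey (key r)
    ∈-rootsWithKey {r} rr = ∈-filter⁺ (rootWithKey? (key r)) (∈-allFin r) (rr , refl)

    ∈-rootsWithKey⁻ : ∀ {κ r} → r ∈ₗ rootsWithKey κ → root r ≡ r × key r ≡ κ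
    ∈-rootsWithKey⁻ {κ} r∈ = proj₂ (∈-filter⁻ (rootWithKey? κ) {xs = allFin N} r∈)

    rank-< : ∀ {r} → root r ≡ r → rank r < classSize r
    rank-< rr = indexOf-< (∈-rootsWithKey rr)

    rank-injective : ∀ {r s} → root r ≡ r → root s ≡ s → key r ≡ key s → rank r ≡ rank s → r ≡ s
    rank-injective {r} {s} rr rs same eq = indexOf-injective
      (subst (λ κ → r ∈ₗ rootsWithKey κ) same (∈-rootsWithKey rr)) (∈-rootsWithKey rs)
      (trans (cong (λ κ → indexOf r (rootsWithKey κ)) (≡.sym same)) eq)

    rankedRoot-isRoot : ∀ r {q} → q < classSize r → root (rankedRoot r q) ≡ rankedRoot r q
    rankedRoot-isRoot r q< = proj₁ (∈-rootsWithKey⁻ (nth-∈ r (rootsWithKey (key r)) q<))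

    rankedRoot-key : ∀ r {q} → q < classSize r → key (rankedRoot r q) ≡ key r
    rankedRoot-key r q< = proj₂ (∈-rootsWithKey⁻ (nth-∈ r (rootsWithKey (key r)) q<))

    rankedRoot-rank : ∀ r {q} → q < classSize r → rank (rankedRoot r q) ≡ q
    rankedRoot-rank r {q} q< =
      trans (cong (λ κ → indexOf (rankedRoot r q) (rootsWithKey κ)) (rankedRoot-key r q<))
            (indexOf-nth r (Uniqueₚ.filter⁺ (rootWithKey? (key r)) (Uniqueₚ.allFin⁺ N)) q<)

    -- The roots of each key are cut into consecutive blocks of k by rank; only complete blocks are
    -- kept, and the first root of a kept block is its leader.
    keptCount : Fin N → ℕ
    keptCount r = (classSize r / k) * k

    keptCount-cong : ∀ {r s} → key r ≡ key s → keptCount r ≡ keptCount s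
    keptCount-cong = cong (λ κ → (length (rootsWithKey κ) / k) * k)

    Kept : Fin N → Set
    Kept r = rank r < keptCount r

    kept? : ∀ r → Dec (Kept r)
    kept? r = rank r <? keptCount r

    Leader : Fin N → Set
    Leader r = Kept r × k ∣ rank r

    leader? : ∀ r → Dec (Leader r)
    leader? r = kept? r ×-dec (k ∣? rank r)

    shift : ℕ → Fin N → Fin N
    shift i r = rankedRoot r (rank r + i)

    module Block {r} (rr : root r ≡ r) (leader : Leader r) {i} (i<k : i < k) where

      rank+i<keptCount : rank r + i < keptCount r
      rank+i<keptCount = block-< {q = classSize r / k} (proj₂ leader) (proj₁ leader) i<k

      rank+i<classSize : rank r + i < classSize r
      rank+i<classSize = <-≤-trans rank+i<keptCount (m/n*n≤m (classSize r) k)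

      shift-isRoot : root (shift i r) ≡ shift i r
      shift-isRoot = rankedRoot-isRoot r rank+i<classSize

      shift-key : key (shift i r) ≡ key r
      shift-key = rankedRoot-key r rank+i<classSize

      shift-rank : rank (shift i r) ≡ rank r + i
      shift-rank = rankedRoot-rank r rank+i<classSize

      shift-kept : Kept (shift i r)
      shift-kept = subst₂ _<_ (≡.sym shift-rank) (keptCount-cong (≡.sym shift-key)) rank+i<keptCount

      open Transport rr shift-isRoot (≡.sym shift-key) public

    shift-injective : ∀ {r s i j} → root r ≡ r → root s ≡ s → Leader r → Leader s → i < k → j < k →
                      shift i r ≡ shift j s → i ≡ j × r ≡ s
    shift-injective {r} {s} {i} {j} rr rs lr ls i<k j<k eq = i≡j , rank-injective rr rs same-key rank≡
      where
      module R = Block rr lr i<k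
      module S = Block rs ls j<k
      same-key : key r ≡ key s
      same-key = trans (≡.sym R.shift-key) (trans (cong key eq) S.shift-key)
      shifted-ranks : rank r + i ≡ rank s + j
      shifted-ranks = trans (≡.sym R.shift-rank) (trans (cong rank eq) S.shift-rank)
      i≡j : i ≡ j
      i≡j = offset-unique (proj₂ lr) (proj₂ ls) i<k j<k shifted-ranks
      rank≡ : rank r ≡ rank s
      rank≡ = +-cancelʳ-≡ i (rank r) (rank s) (trans shifted-ranks (cong (rank s +_) (≡.sym i≡j)))

    Φ : ℕ → Fin N → Fin N
    Φ i x = transport (root x) (shift i (root x)) x

    Φ-sameRoot : ∀ {x y} i → root y ≡ root x → Φ i y ≡ transport (root x) (shift i (root x)) y
    Φ-sameRoot {y = y} i ry≡rx = cong (λ ρ → transport ρ (shift i ρ) y) ry≡rx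

    module Copy {x} (lx : Leader (root x)) {i} (i<k : i < k) where
      open Block (root-idem x) lx i<k public

      root-Φ : root (Φ i x) ≡ shift i (root x)
      root-Φ = transport-root refl

    Φ-kept : ∀ {x i} → Leader (root x) → i < k → Kept (root (Φ i x))
    Φ-kept lx i<k = subst Kept (≡.sym root-Φ) shift-kept
      where open Copy lx i<k

    Φ-isRoot : ∀ {x i} → RH x → Leader (root x) → i < k → RH (Φ i x)
    Φ-isRoot {x} {i} RHx lx i<k = subst RH (≡.sym Φx≡shift) (subst RH shift-isRoot (root-isRoot _))
      where
      open Copy lx i<k
      Φx≡shift : Φ i x ≡ shift i (root x)
      Φx≡shift = trans (cong (transport (root x) (shift i (root x))) (≡.sym (isRoot⇒root≡ RHx)))
                       (transport-self (root x) (shift i (root x)))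

    Φ-adj : ∀ {x y i} → Leader (root x) → i < k → Adj H x y → Adj H (Φ i x) (Φ i y)
    Φ-adj {x} {y} {i} lx i<k e =
      subst (Adj H (Φ i x)) (≡.sym (Φ-sameRoot i ry≡rx)) (transport-adj refl ry≡rx e)
      where
      open Copy lx i<k
      ry≡rx = ≡.sym (adj⇒root≡ e)

    Φ-roots : ∀ {x y i j} → Leader (root x) → Leader (root y) → i < k → j < k →
              root (Φ i x) ≡ root (Φ j y) → i ≡ j × root x ≡ root y
    Φ-roots lx ly i<k j<k eq = shift-injective (root-idem _) (root-idem _) lx ly i<k j<k
      (trans (≡.sym (Copy.root-Φ lx i<k)) (trans eq (Copy.root-Φ ly j<k)))

    Φ-injective : ∀ {x y i j} → Leader (root x) → Leader (root y) → i < k → j < k →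
                  Φ i x ≡ Φ j y → i ≡ j × x ≡ y
    Φ-injective {x} {y} {i} {j} lx ly i<k j<k eq = i≡j , transport-injective refl (≡.sym rx≡ry) Φix≡Φiy
      where
      open Copy lx i<k
      i≡j = proj₁ (Φ-roots lx ly i<k j<k (cong root eq))
      rx≡ry = proj₂ (Φ-roots lx ly i<k j<k (cong root eq))
      Φix≡Φiy : Φ i x ≡ transport (root x) (shift i (root x)) y
      Φix≡Φiy = trans eq (trans (cong (λ t → Φ t y) (≡.sym i≡j)) (Φ-sameRoot i (≡.sym rx≡ry)))

    Φ-reflects-adj : ∀ {x y i j} → Leader (root x) → Leader (root y) → i < k → j < k →
                     Adj H (Φ i x) (Φ j y) → i ≡ j × Adj H x y
    Φ-reflects-adj {x} {y} {i} {j} lx ly i<k j<k e =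
      i≡j , transport-reflects-adj (root-idem x) shift-isRoot (≡.sym shift-key) refl (≡.sym rx≡ry) e′
      where
      open Copy lx i<k
      i≡j = proj₁ (Φ-roots lx ly i<k j<k (adj⇒root≡ e))
      rx≡ry = proj₂ (Φ-roots lx ly i<k j<k (adj⇒root≡ e))
      e′ : Adj H (Φ i x) (transport (root x) (shift i (root x)) y)
      e′ = subst (Adj H (Φ i x)) (trans (cong (λ t → Φ t y) (≡.sym i≡j)) (Φ-sameRoot i (≡.sym rx≡ry))) e

    Φ-onto : ∀ v → Kept (root v) → ∃[ i ] ∃[ x ] (i < k × Leader (root x) × Φ i x ≡ v)
    Φ-onto v kept = i , x , i<k , subst Leader (≡.sym rx≡r₀) leader₀ , Φix≡v
      where
      r = root v
      rr = root-idem v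
      q₀ = (rank r / k) * k
      q₀<classSize = ≤-<-trans (m/n*n≤m (rank r) k) (rank-< rr)
      r₀ = rankedRoot r q₀
      rr₀ = rankedRoot-isRoot r q₀<classSize
      key₀ = rankedRoot-key r q₀<classSize
      rank₀ = rankedRoot-rank r q₀<classSize
      leader₀ : Leader r₀
      leader₀ = subst₂ _<_ (≡.sym rank₀) (keptCount-cong (≡.sym key₀)) (≤-<-trans (m/n*n≤m (rank r) k) kept)
              , subst (k ∣_) (≡.sym rank₀) (n∣m*n (rank r / k))
      i = rank r % k
      i<k = m%n<n (rank r) k
      open Transport rr rr₀ (≡.sym key₀)
      x = transport r r₀ v
      rx≡r₀ : root x ≡ r₀
      rx≡r₀ = transport-root refl
      shift≡r : shift i r₀ ≡ r
      shift≡r = rank-injective (Block.shift-isRoot rr₀ leader₀ i<k) rr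
        (trans (Block.shift-key rr₀ leader₀ i<k) key₀)
        (trans (Block.shift-rank rr₀ leader₀ i<k)
               (trans (cong (_+ i) rank₀) (trans (+-comm q₀ i) (≡.sym (m≡m%n+[m/n]*n (rank r) k)))))
      Φix≡v : Φ i x ≡ v
      Φix≡v = begin
        Φ i x                        ≡⟨ cong (λ ρ → transport ρ (shift i ρ) x) rx≡r₀ ⟩
        transport r₀ (shift i r₀) x  ≡⟨ cong (λ ρ → transport r₀ ρ x) shift≡r ⟩
        transport r₀ r x             ≡⟨ transport-inverse refl ⟩
        v                            ∎
        where open ≡-Reasoning

    open Induced H (leader? ∘ root) public
      using (order; embed; embed-P; embed-injective; preimage; embed-preimage; induced; induced-rooted)

    F : Graph (Fin order)
    F = induced

    RF : Fin order → Set
    RF = RH ∘ embed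

    F-rooted : IsRootedForest F RF
    F-rooted = induced-rooted (λ e → subst Leader (adj⇒root≡ e)) rooted

    deleted? : ∀ v → Dec (¬ Kept (root v))
    deleted? v = ¬? (kept? (root v))

    D : Subset N
    D = select deleted?

    ∉D⇒kept : ∀ {v} → v ∉ D → Kept (root v)
    ∉D⇒kept {v} v∉D = decidable-stable (kept? (root v)) (v∉D ∘ ∈-select⁺ deleted?)

    φ : Fin k × Fin order → Fin N
    φ (i , a) = Φ (toℕ i) (embed a)

    iso : RootedIsoOntoMinus H RH D (F ×ᵍ k) (RF ×ʳ k)
    iso = record
      { φ         = φ
      ; injective = injective
      ; avoids    = λ (i , a) φ∈D → ∈-select⁻ deleted? φ∈D (Φ-kept (embed-P a) (toℕ<n i))
      ; onto      = onto
      ; adj⇒      = λ { (i , a) (_ , b) (refl , e) → Φ-adj (embed-P a) (toℕ<n i) e }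
      ; adj⇐      = adj⇐
      ; roots     = λ (i , a) RFa → Φ-isRoot RFa (embed-P a) (toℕ<n i)
      }
      where
      injective : Injective _≡_ _≡_ φ
      injective {i , a} {j , b} eq =
        let i≡j , x≡y = Φ-injective (embed-P a) (embed-P b) (toℕ<n i) (toℕ<n j) eq
        in cong₂ _,_ (Finₚ.toℕ-injective i≡j) (embed-injective x≡y)

      onto : ∀ v → v ∉ D → ∃[ w ] (φ w ≡ v)
      onto v v∉D =
        let i , x , i<k , lx , Φix≡v = Φ-onto v (∉D⇒kept v∉D)
        in (fromℕ< i<k , preimage lx) , trans (cong₂ Φ (toℕ-fromℕ< i<k) (embed-preimage lx)) Φix≡v

      adj⇐ : ∀ w w′ → Adj H (φ w) (φ w′) → Adj (F ×ᵍ k) w w′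
      adj⇐ (i , a) (j , b) e =
        let i≡j , e′ = Φ-reflects-adj (embed-P a) (embed-P b) (toℕ<n i) (toℕ<n j) e
        in Finₚ.toℕ-injective i≡j , e′

    excess : Fin N → ℕ
    excess r = rank r ∸ keptCount r

    excess-< : ∀ {v} → v ∈ D → excess (root v) < k
    excess-< {v} v∈D = remainder-offset-< (rank-< (root-idem v)) (≮⇒≥ (∈-select⁻ deleted? v∈D))

    position<m : ∀ v → position (root v) v < m
    position<m v = <-≤-trans (position-< refl) (size≤m (root v))

    -- A deleted vertex is determined by its position in its component, the rank of its root beyond
    -- the kept blocks, and the key of its root.
    encode : ∀ v → v ∈ D → Fin (m * (k * m ^ m))
    encode v v∈D = combine (fromℕ< (position<m v)) (combine (fromℕ< (excess-< v∈D)) (key (root v)))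

    encode-injective : ∀ {v w} v∈D w∈D → encode v v∈D ≡ encode w w∈D → v ≡ w
    encode-injective {v} {w} v∈D w∈D eq = position-injective refl (≡.sym rv≡rw) position≡
      where
      open ≡-Reasoning
      rv = root v
      rw = root w
      halves = combine-injective {m = m} {n = k * m ^ m} _ _ _ _ eq
      rest = combine-injective {m = k} {n = m ^ m} _ _ _ _ (proj₂ halves)
      key≡ : key rv ≡ key rw
      key≡ = proj₂ rest
      excess≡ : excess rv ≡ excess rw
      excess≡ = fromℕ<-injective _ _ (excess-< v∈D) (excess-< w∈D) (proj₁ rest)
      rank≡ : rank rv ≡ rank rw
      rank≡ = begin
        rank rv                   ≡⟨ m∸n+n≡m (≮⇒≥ (∈-select⁻ deleted? v∈D)) ⟨
        excess rv + keptCount rv  ≡⟨ cong₂ _+_ excess≡ (keptCount-cong key≡) ⟩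
        excess rw + keptCount rw  ≡⟨ m∸n+n≡m (≮⇒≥ (∈-select⁻ deleted? w∈D)) ⟩
        rank rw                   ∎
      rv≡rw : rv ≡ rw
      rv≡rw = rank-injective (root-idem v) (root-idem w) key≡ rank≡
      position≡ : position rv v ≡ position rv w
      position≡ = trans (fromℕ<-injective _ _ (position<m v) (position<m w) (proj₁ halves))
                        (cong (λ ρ → position ρ w) (≡.sym rv≡rw))

    D-bound : ∣ D ∣ ≤ m ^ (m + 1) * k
    D-bound = subst (∣ D ∣ ≤_) (m*[k*m^m]≡m^[m+1]*k m k) (∣p∣≤-injection D encode encode-injective)

open import Defs
open import Data.Nat using (ℕ; _≤_; _*_; _^_; _+_; zero; suc; NonZero)
open import Data.Integer using (+_)
open import Data.Rational using (ℚ; _/_; 0ℚ; _<_; positive) renaming (_*_ to _*ℚ_)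
open import Data.Rational.Properties using (<-irrefl; pos*pos⇒pos; positive⁻¹; normalize-pos)
open import Data.Fin using (Fin)
open import Data.Fin.Subset using (Subset; ∣_∣)
open import Data.Empty using (⊥-elim)
open import Data.Product using (Σ; _×_; _,_)
open import Relation.Binary.PropositionalEquality using (_≡_; refl; subst)
open RootedForestDecomposition using (module Decomposition)

positive-product-nonZero : ∀ n → 1 ≤ n → ∀ ζ → 0ℚ < ζ → ∀ k → ζ *ℚ (+ n / 1) ≡ + k / 1 → NonZero k
positive-product-nonZero (suc n) _ ζ 0<ζ zero ζn≡0 = ⊥-elim (<-irrefl refl (subst (0ℚ <_) ζn≡0 0<ζn))
  where
  0<ζn : 0ℚ < ζ *ℚ (+ suc n / 1)
  0<ζn = positive⁻¹ _ {{pos*pos⇒pos ζ {{positive 0<ζ}} (+ suc n / 1) {{normalize-pos (suc n) 1}}}}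
positive-product-nonZero _ _ _ _ (suc k) _ = _

lemma4p6 : (m n : ℕ) → 1 ≤ n → (ζ : ℚ) → 0ℚ < ζ → (k : ℕ) → ζ *ℚ (+ n / 1) ≡ + k / 1 →
    (N : ℕ) (H : Graph (Fin N)) (RH : Fin N → Set) →
    IsRootedForest H RH → ComponentsAtMost H m →
    Σ (Subset N) λ D → ∣ D ∣ ≤ m ^ (m + 1) * k ×
      (Σ ℕ λ M → Σ (Graph (Fin M)) λ F → Σ (Fin M → Set) λ RF →
        IsRootedForest F RF × RootedIsoOntoMinus H RH D (F ×ᵍ k) (RF ×ʳ k))
lemma4p6 m n 1≤n ζ 0<ζ k ζn≡k N H RH rooted small = D , D-bound , order , F , RF , F-rooted , iso
  where
  instance
    k-nonZero : NonZero k
    k-nonZero = positive-product-nonZero n 1≤n ζ 0<ζ k ζn≡k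
  open Decomposition H RH rooted m small k
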